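{- Let $\Gamma=\langle\alpha,\beta\rangle$ be a numerical semigroup generated by two coprime integers $\alpha,\beta\ge2$. Then, with $g$ ranging over the gaps of $\Gamma$, \[ \max_{g}W(g)=-\min_{g}W(g)<\delta(\Gamma). \]
   Context: A numerical semigroup is an additive submonoid $\Gamma\subseteq\mathbb{N}$ with finite complement; its elements not in $\Gamma$ are gaps. For $\Delta\subseteq\mathbb{N}$ with finite complement, $c(\Delta)$ is one more than the largest element of $\mathbb{N}\setminus\Delta$ and $\delta(\Delta)=|\{x\in\Delta:x<c(\Delta)\}|$. For a gap $g$ of $\Gamma$, let $\Delta_g=\Gamma\cup(g+\Gamma)$ (the $\Gamma$-semimodule minimally generated by $\{0,g\}$) and $W(g)=2\delta(\Delta_g)-c(\Delta_g)$. -}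

module Defs where

open import Data.Nat using (ℕ; zero; suc; _+_; _*_; _∸_; _≤_; _≤ᵇ_; _≡ᵇ_)
open import Data.Bool using (Bool; true; false; _∧_; _∨_; if_then_else_)
open import Data.List using (List; upTo)
open import Data.Bool.ListAction using (any)
open import Data.Product using (_×_)
open import Data.Integer as ℤ using (ℤ; +_)
open import Relation.Binary.PropositionalEquality using (_≡_)
open import Relation.Nullary using (¬_)

-- For α, β ≥ 1 any
-- representation n = aα + bβ has a, b ≤ n, so the search is over a, b ≤ n.
inΓ : ℕ → ℕ → ℕ → Bool
inΓ α β n = any (λ a → any (λ b → (a * α + b * β) ≡ᵇ n) (upTo (suc n))) (upTo (suc n))

inΔ : ℕ → ℕ → ℕ → ℕ → Bool
inΔ α β g n = inΓ α β n ∨ ((g ≤ᵇ n) ∧ inΓ α β (n ∸ g))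

Gap : ℕ → ℕ → ℕ → Set
Gap α β g = inΓ α β g ≡ false

-- c is the conductor of Δ (one more than the largest non-element, or 0 if
-- Δ = ℕ): every n ≥ c lies in Δ, and c - 1 does not (when c > 0).
IsConductor : (ℕ → Bool) → ℕ → Set
IsConductor Δ c = (∀ n → c ≤ n → Δ n ≡ true) × (∀ k → c ≡ suc k → Δ k ≡ false)

countBelow : (ℕ → Bool) → ℕ → ℕ
countBelow Δ zero = zero
countBelow Δ (suc c) = countBelow Δ c + (if Δ c then 1 else 0)

δ : (ℕ → Bool) → ℕ → ℕ
δ Δ c = countBelow Δ c

W : ℕ → ℕ → ℕ → ℕ → ℤ
W α β g c = (+ (2 * δ (inΔ α β g) c)) ℤ.- (+ c)

module Submission where

-- Every gap of Γ = ⟨α, β⟩ is αβ − xα − yβ for unique x, y ≥ 1. Hence Γ has conductor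
-- C = (α − 1)(β − 1) and n ↦ C − 1 − n exchanges gaps and elements, so 2δ(Γ) = C.
-- For the gap g = αβ − pα − qβ, the gaps of Γ lying in g + Γ are those with x ≤ p and y ≤ q,
-- so below C the semimodule Δ_g has pq more elements than Γ. If pα < qβ, the largest element
-- missing from Δ_g is αβ − (p + 1)α − β when this is nonnegative, and then W(g) = 2pq − pα;
-- otherwise Δ_g = ℕ and W(g) = 0. The gap g′ = qβ − pα = αβ − pα − (α − q)β is of the same kind
-- and has W(g′) = −W(g), so the values of W are symmetric about 0; the case pα > qβ follows by
-- exchanging α and β. Finally, with q′ = α − q, W(g) = p(q − q′), and pα < q′β together with
-- AM-GM gives 8p(q − q′) < αβ ≤ 4C = 8δ(Γ).

open import Defs
open import Data.Bool using (Bool; true; false; not; _∨_; _∧_; if_then_else_; T)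
open import Data.Bool.Properties using (¬-not; T-≡; ∨-zeroʳ) renaming (_≟_ to _≟ᵇ_)
open import Data.Bool.ListAction using (any)
open import Data.Empty using (⊥-elim)
open import Data.Integer as ℤ using (ℤ; _⊖_)
import Data.Integer.Properties as ℤ
open import Data.List using (List; upTo; filter)
import Data.List.Extrema ℤ.≤-totalOrder as ℤ-Extrema
open import Data.List.Membership.Propositional using (_∈_; lose)
open import Data.List.Membership.Propositional.Properties using (∈-upTo⁺; ∈-filter⁺)
open import Data.List.Relation.Unary.All.Properties using (all-filter)
open import Data.List.Relation.Unary.Any using (satisfied)
open import Data.List.Relation.Unary.Any.Properties using (any⁺; any⁻)
open import Data.Nat
open import Data.Nat.Properties
open import Data.Nat.Coprimality as Coprime using (Coprime; coprime-divisor; coprime-Bézout)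
open import Data.Nat.Divisibility using (_∣_; divides; ∣m+n∣m⇒∣n; ∣⇒≤)
open import Data.Nat.DivMod using (_%_; _/_; m≡m%n+[m/n]*n; m%n<n)
open import Data.Nat.GCD using (module Bézout)
open import Data.Nat.Tactic.RingSolver using (solve-∀)
open import Data.Product using (Σ; ∃; ∃₂; _×_; _,_; proj₁)
open import Data.Sum using (_⊎_; inj₁; inj₂)
open import Function using (Equivalence; case_of_)
open import Relation.Binary.PropositionalEquality
open import Relation.Nullary using (Dec; yes; no)
open import Relation.Binary.Definitions using (tri<; tri≈; tri>)

∨-true⁻ : ∀ a {b} → a ∨ b ≡ true → a ≡ true ⊎ b ≡ true
∨-true⁻ true  _ = inj₁ refl
∨-true⁻ false e = inj₂ e

∨-trueˡ : ∀ {a} b → a ≡ true → a ∨ b ≡ true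
∨-trueˡ _ refl = refl

∨-trueʳ : ∀ a {b} → b ≡ true → a ∨ b ≡ true
∨-trueʳ a refl = ∨-zeroʳ a

∧-true⁻ : ∀ a {b} → a ∧ b ≡ true → a ≡ true × b ≡ true
∧-true⁻ true e = refl , e

Bool-ext : ∀ {a b : Bool} → (a ≡ true → b ≡ true) → (b ≡ true → a ≡ true) → a ≡ b
Bool-ext {false} {false} _ _ = refl
Bool-ext {false} {true}  _ g = g refl
Bool-ext {true}  {false} f _ = sym (f refl)
Bool-ext {true}  {true}  _ _ = refl

≡true⇒T : ∀ {b} → b ≡ true → T b
≡true⇒T = Equivalence.from T-≡

T⇒≡true : ∀ {b} → T b → b ≡ true
T⇒≡true = Equivalence.to T-≡

≡ᵇ-true⁻ : ∀ m n → (m ≡ᵇ n) ≡ true → m ≡ n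
≡ᵇ-true⁻ m n e = ≡ᵇ⇒≡ m n (≡true⇒T e)

≡ᵇ-true⁺ : ∀ {m n} → m ≡ n → (m ≡ᵇ n) ≡ true
≡ᵇ-true⁺ {m} {n} e = T⇒≡true (≡⇒≡ᵇ m n e)

-- Counting the members of a set below a bound

𝟙 : Bool → ℕ
𝟙 b = if b then 1 else 0

countBelow-cong : ∀ f h N → (∀ n → n < N → f n ≡ h n) → countBelow f N ≡ countBelow h N
countBelow-cong f h zero    _  = refl
countBelow-cong f h (suc N) eq =
  cong₂ (λ k b → k + 𝟙 b) (countBelow-cong f h N (λ n n<N → eq n (m<n⇒m<1+n n<N))) (eq N ≤-refl)

𝟙-∨ : ∀ a b → (a ≡ true → b ≡ false) → 𝟙 (a ∨ b) ≡ 𝟙 a + 𝟙 b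
𝟙-∨ true  b disj rewrite disj refl = refl
𝟙-∨ false b _ = refl

countBelow-∨ : ∀ f h N → (∀ n → f n ≡ true → h n ≡ false) →
               countBelow (λ n → f n ∨ h n) N ≡ countBelow f N + countBelow h N
countBelow-∨ f h zero    _    = refl
countBelow-∨ f h (suc N) disj = begin
  countBelow (λ n → f n ∨ h n) N + 𝟙 (f N ∨ h N)
    ≡⟨ cong₂ _+_ (countBelow-∨ f h N disj) (𝟙-∨ (f N) (h N) (disj N)) ⟩
  (countBelow f N + countBelow h N) + (𝟙 (f N) + 𝟙 (h N))
    ≡⟨ interchange (countBelow f N) (countBelow h N) (𝟙 (f N)) (𝟙 (h N)) ⟩
  (countBelow f N + 𝟙 (f N)) + (countBelow h N + 𝟙 (h N)) ∎
  where
  open ≡-Reasoning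
  interchange : ∀ a b c d → (a + b) + (c + d) ≡ (a + c) + (b + d)
  interchange = solve-∀

countBelow-empty : ∀ f N → (∀ n → n < N → f n ≡ false) → countBelow f N ≡ 0
countBelow-empty f zero    _     = refl
countBelow-empty f (suc N) empty rewrite empty N ≤-refl =
  trans (+-identityʳ _) (countBelow-empty f N (λ n n<N → empty n (m<n⇒m<1+n n<N)))

countBelow-full-interval : ∀ f m k → (∀ n → m ≤ n → f n ≡ true) → countBelow f (m + k) ≡ countBelow f m + k
countBelow-full-interval f m zero    _    = trans (cong (countBelow f) (+-identityʳ m)) (sym (+-identityʳ _))
countBelow-full-interval f m (suc k) full rewrite +-suc m k | full (m + k) (m≤m+n m k) = begin
  countBelow f (m + k) + 1 ≡⟨ cong (_+ 1) (countBelow-full-interval f m k full) ⟩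
  countBelow f m + k + 1   ≡⟨ +-assoc (countBelow f m) k 1 ⟩
  countBelow f m + (k + 1) ≡⟨ cong (countBelow f m +_) (+-comm k 1) ⟩
  countBelow f m + suc k   ∎
  where open ≡-Reasoning

countBelow-singleton : ∀ f k N → k < N → f k ≡ true → (∀ n → f n ≡ true → n ≡ k) → countBelow f N ≡ 1
countBelow-singleton f k (suc N) k<1+N fk only with m≤n⇒m<n∨m≡n (s≤s⁻¹ k<1+N)
... | inj₁ k<N rewrite ¬-not {f N} {true} (λ fN → <⇒≢ k<N (sym (only N fN))) =
  trans (+-identityʳ _) (countBelow-singleton f k N k<N fk only)
... | inj₂ refl rewrite fk =
  cong (_+ 1) (countBelow-empty f k (λ n n<k → ¬-not (λ fn → <⇒≢ n<k (only n fn))))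

countBelow-shift : ∀ f N → countBelow f (suc N) ≡ 𝟙 (f 0) + countBelow (λ n → f (suc n)) N
countBelow-shift f zero    = +-comm 0 _
countBelow-shift f (suc N) =
  trans (cong (_+ 𝟙 (f (suc N))) (countBelow-shift f N)) (+-assoc (𝟙 (f 0)) _ _)

countBelow-reverse : ∀ f N → countBelow (λ n → f (N ∸ suc n)) N ≡ countBelow f N
countBelow-reverse f zero    = refl
countBelow-reverse f (suc N) = begin
  countBelow (λ n → f (N ∸ n)) (suc N)      ≡⟨ countBelow-shift (λ n → f (N ∸ n)) N ⟩
  𝟙 (f N) + countBelow (λ n → f (N ∸ suc n)) N ≡⟨ cong (𝟙 (f N) +_) (countBelow-reverse f N) ⟩
  𝟙 (f N) + countBelow f N                  ≡⟨ +-comm (𝟙 (f N)) _ ⟩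
  countBelow f N + 𝟙 (f N)                  ∎
  where open ≡-Reasoning

countBelow-not : ∀ f N → countBelow f N + countBelow (λ n → not (f n)) N ≡ N
countBelow-not f zero    = refl
countBelow-not f (suc N) = begin
  (countBelow f N + 𝟙 (f N)) + (countBelow (λ n → not (f n)) N + 𝟙 (not (f N)))
    ≡⟨ interchange (countBelow f N) (𝟙 (f N)) _ _ ⟩
  (countBelow f N + countBelow (λ n → not (f n)) N) + (𝟙 (f N) + 𝟙 (not (f N)))
    ≡⟨ cong₂ _+_ (countBelow-not f N) (𝟙-+-𝟙-not (f N)) ⟩
  N + 1 ≡⟨ +-comm N 1 ⟩
  suc N ∎
  where
  open ≡-Reasoning
  interchange : ∀ a b c d → (a + b) + (c + d) ≡ (a + c) + (b + d)
  interchange = solve-∀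
  𝟙-+-𝟙-not : ∀ b → 𝟙 b + 𝟙 (not b) ≡ 1
  𝟙-+-𝟙-not true  = refl
  𝟙-+-𝟙-not false = refl

countBelow-self-dual : ∀ f N → (∀ n → n < N → f n ≡ not (f (N ∸ suc n))) → countBelow f N + countBelow f N ≡ N
countBelow-self-dual f N dual = begin
  countBelow f N + countBelow f N
    ≡⟨ cong (countBelow f N +_) (countBelow-cong f _ N dual) ⟩
  countBelow f N + countBelow (λ n → not (f (N ∸ suc n))) N
    ≡⟨ cong (countBelow f N +_) (countBelow-reverse (λ n → not (f n)) N) ⟩
  countBelow f N + countBelow (λ n → not (f n)) N
    ≡⟨ countBelow-not f N ⟩
  N ∎
  where open ≡-Reasoning

-- Conductors

conductor-least : ∀ {Δ c} c′ → IsConductor Δ c′ → (∀ n → c ≤ n → Δ n ≡ true) → c′ ≤ c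
conductor-least zero _ _ = z≤n
conductor-least {c = c} (suc k) (_ , lastGap) full with c ≤? k
... | yes c≤k with () ← trans (sym (full k c≤k)) (lastGap k refl)
... | no  c≰k = ≰⇒> c≰k

conductor-unique : ∀ {Δ c₁ c₂} → IsConductor Δ c₁ → IsConductor Δ c₂ → c₁ ≡ c₂
conductor-unique {c₁ = c₁} {c₂} cond₁ cond₂ =
  ≤-antisym (conductor-least c₁ cond₁ (proj₁ cond₂)) (conductor-least c₂ cond₂ (proj₁ cond₁))

conductor-cong : ∀ {Δ Δ′ c} → (∀ n → Δ n ≡ Δ′ n) → IsConductor Δ c → IsConductor Δ′ c
conductor-cong eq (full , lastGap) =
  (λ n c≤n → trans (sym (eq n)) (full n c≤n)) , (λ k c≡1+k → trans (sym (eq k)) (lastGap k c≡1+k))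

conductorBelow : (ℕ → Bool) → ℕ → ℕ
conductorBelow Δ zero    = zero
conductorBelow Δ (suc N) = if Δ N then conductorBelow Δ N else suc N

conductorBelow-isConductor : ∀ Δ N → (∀ n → N ≤ n → Δ n ≡ true) → IsConductor Δ (conductorBelow Δ N)
conductorBelow-isConductor Δ zero    full = full , λ _ ()
conductorBelow-isConductor Δ (suc N) full with Δ N in ΔN
... | false = full , λ { _ refl → ΔN }
... | true  = conductorBelow-isConductor Δ N full′
  where
  full′ : ∀ n → N ≤ n → Δ n ≡ true
  full′ n N≤n with m≤n⇒m<n∨m≡n N≤n
  ... | inj₁ N<n  = full n N<n
  ... | inj₂ refl = ΔN

⊖-cross : ∀ {a b c d} → a + d ≡ c + b → a ⊖ c ≡ b ⊖ d
⊖-cross {a} {b} {c} {d} e = begin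
  a ⊖ c             ≡⟨ ℤ.+-cancelˡ-⊖ d a c ⟨
  (d + a) ⊖ (d + c) ≡⟨ cong₂ _⊖_ (trans (+-comm d a) e) (+-comm d c) ⟩
  (c + b) ⊖ (c + d) ≡⟨ ℤ.+-cancelˡ-⊖ c b d ⟩
  b ⊖ d             ∎
  where open ≡-Reasoning

⊖<ℤ : ∀ {m n k} → m < k + n → m ⊖ n ℤ.< ℤ.+ k
⊖<ℤ {m} {n} {k} m<k+n = begin-strict
  m ⊖ n       <⟨ ℤ.⊖-monoˡ-< n m<k+n ⟩
  (k + n) ⊖ n ≡⟨ ℤ.⊖-≥ (m≤n+m n k) ⟩
  ℤ.+ (k + n ∸ n) ≡⟨ cong ℤ.+_ (m+n∸n≡m k n) ⟩
  ℤ.+ k       ∎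
  where open ℤ.≤-Reasoning

inΓ-sound : ∀ α β n → inΓ α β n ≡ true → ∃₂ λ a b → a * α + b * β ≡ n
inΓ-sound α β n n∈Γ
  with a , found-b ← satisfied (any⁻ (λ a → any (λ b → (a * α + b * β) ≡ᵇ n) (upTo (suc n))) (upTo (suc n)) (≡true⇒T n∈Γ))
  with b , found   ← satisfied (any⁻ (λ b → (a * α + b * β) ≡ᵇ n) (upTo (suc n)) found-b)
  = a , b , ≡ᵇ⇒≡ _ n found

inΓ-complete : ∀ {α β n} a b → 1 ≤ α → 1 ≤ β → a * α + b * β ≡ n → inΓ α β n ≡ true
inΓ-complete {α} {β} a b 1≤α 1≤β refl =
  T⇒≡true (any⁺ _ (lose (∈-upTo⁺ (s≤s a≤n))
    (any⁺ (λ b′ → (a * α + b′ * β) ≡ᵇ n) (lose (∈-upTo⁺ (s≤s b≤n)) (≡⇒≡ᵇ n n refl)))))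
  where
  n = a * α + b * β
  a≤n : a ≤ n
  a≤n = ≤-trans (m≤m*n a α {{>-nonZero 1≤α}}) (m≤m+n (a * α) (b * β))
  b≤n : b ≤ n
  b≤n = ≤-trans (m≤m*n b β {{>-nonZero 1≤β}}) (m≤n+m (b * β) (a * α))

1∉Γ : ∀ {α β} → 2 ≤ α → 2 ≤ β → inΓ α β 1 ≡ false
1∉Γ {α} {β} 2≤α 2≤β = ¬-not λ 1∈Γ → let a , b , eq = inΓ-sound α β 1 1∈Γ in no-sum a b eq
  where
  no-sum : ∀ a b → a * α + b * β ≢ 1
  no-sum zero    zero    ()
  no-sum zero    (suc b) eq = <⇒≱ 2≤β (≤-trans (m≤m+n β (b * β)) (≤-reflexive eq))
  no-sum (suc a) b       eq = <⇒≱ 2≤α (≤-trans (≤-trans (m≤m+n α (a * α)) (m≤m+n _ (b * β))) (≤-reflexive eq))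

inShift : ℕ → ℕ → ℕ → ℕ → Bool
inShift α β g n = (g ≤ᵇ n) ∧ inΓ α β (n ∸ g)

inShift-sound : ∀ α β g n → inShift α β g n ≡ true → ∃ λ m → n ≡ g + m × inΓ α β m ≡ true
inShift-sound α β g n e with g≤n , m∈Γ ← ∧-true⁻ (g ≤ᵇ n) e =
  n ∸ g , sym (m+[n∸m]≡n (≤ᵇ⇒≤ g n (≡true⇒T g≤n))) , m∈Γ

inShift-complete : ∀ α β g m → inΓ α β m ≡ true → inShift α β g (g + m) ≡ true
inShift-complete α β g m m∈Γ rewrite T⇒≡true (≤⇒≤ᵇ (m≤m+n g m)) | m+n∸m≡n g m = m∈Γ

inΓ-comm : ∀ α β n → 1 ≤ α → 1 ≤ β → inΓ α β n ≡ inΓ β α n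
inΓ-comm α β n 1≤α 1≤β = Bool-ext (swap α β 1≤β 1≤α) (swap β α 1≤α 1≤β)
  where
  swap : ∀ α β → 1 ≤ β → 1 ≤ α → inΓ α β n ≡ true → inΓ β α n ≡ true
  swap α β 1≤β 1≤α n∈Γ with a , b , refl ← inΓ-sound α β n n∈Γ = inΓ-complete b a 1≤β 1≤α (+-comm (b * β) (a * α))

inΔ-comm : ∀ α β g n → 1 ≤ α → 1 ≤ β → inΔ α β g n ≡ inΔ β α g n
inΔ-comm α β g n 1≤α 1≤β =
  cong₂ (λ u v → u ∨ ((g ≤ᵇ n) ∧ v)) (inΓ-comm α β n 1≤α 1≤β) (inΓ-comm α β (n ∸ g) 1≤α 1≤β)

W-comm : ∀ α β g c → 1 ≤ α → 1 ≤ β → W α β g c ≡ W β α g c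
W-comm α β g c 1≤α 1≤β =
  cong (λ k → ℤ.+ (2 * k) ℤ.- ℤ.+ c) (countBelow-cong _ _ c (λ n _ → inΔ-comm α β g n 1≤α 1≤β))

-- Representations in a two-generated semigroup

coprime-multiple-small : ∀ {α β k j} → Coprime α β → k * α ≡ j * β → k < β → k ≡ 0
coprime-multiple-small {k = zero}  _        _ _   = refl
coprime-multiple-small {α} {β} {suc k} {j} coprime kα≡jβ k<β =
  ⊥-elim (<⇒≱ k<β (∣⇒≤ (coprime-divisor (Coprime.sym coprime) (divides j (trans (*-comm α (suc k)) kα≡jβ)))))

coprime-inverse : ∀ {α β} → 1 ≤ β → Coprime α β → ∃₂ λ u v → 1 + v * α ≡ u * β
coprime-inverse {α} {β} 1≤β coprime with coprime-Bézout coprime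
... | Bézout.-+ x y eq = y , x , eq
... | Bézout.+- x y eq = (β ∸ 1) * y + 1 , (β ∸ 1) * x , invert β 1≤β eq
  where
  -- multiply 1 + yβ = xα by β - 1
  invert : ∀ β → 1 ≤ β → 1 + y * β ≡ x * α → 1 + (β ∸ 1) * x * α ≡ ((β ∸ 1) * y + 1) * β
  invert (suc b) _ eq = begin
    1 + b * x * α       ≡⟨ cong suc (*-assoc b x α) ⟩
    1 + b * (x * α)     ≡⟨ cong (λ z → 1 + b * z) eq ⟨
    1 + b * (1 + y * suc b) ≡⟨ rearrange b y ⟩
    (b * y + 1) * suc b ∎
    where
    open ≡-Reasoning
    rearrange : ∀ b y → 1 + b * (1 + y * suc b) ≡ (b * y + 1) * suc b
    rearrange = solve-∀

coefficient-unique-≤ : ∀ {α β x y x′ y′} → Coprime α β → x * α + y * β ≡ x′ * α + y′ * β →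
                       x ≤ x′ → x′ < β → x ≡ x′
coefficient-unique-≤ {α} {β} {x} {y} {x′} {y′} coprime eq x≤x′ x′<β = begin
  x            ≡⟨ +-identityʳ x ⟨
  x + 0        ≡⟨ cong (x +_) k≡0 ⟨
  x + (x′ ∸ x) ≡⟨ m+[n∸m]≡n x≤x′ ⟩
  x′           ∎
  where
  open ≡-Reasoning
  k = x′ ∸ x
  yβ≡kα+y′β : y * β ≡ k * α + y′ * β
  yβ≡kα+y′β = +-cancelˡ-≡ (x * α) _ _ (begin
    x * α + y * β            ≡⟨ eq ⟩
    x′ * α + y′ * β          ≡⟨ cong (λ z → z * α + y′ * β) (m+[n∸m]≡n x≤x′) ⟨
    (x + k) * α + y′ * β     ≡⟨ ring x k α y′ β ⟩
    x * α + (k * α + y′ * β) ∎)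
    where
    ring : ∀ x k α y β → (x + k) * α + y * β ≡ x * α + (k * α + y * β)
    ring = solve-∀
  k≡0 : k ≡ 0
  k≡0 = coprime-multiple-small {j = y ∸ y′} coprime (begin
    k * α                   ≡⟨ m+n∸n≡m (k * α) (y′ * β) ⟨
    k * α + y′ * β ∸ y′ * β ≡⟨ cong (_∸ y′ * β) yβ≡kα+y′β ⟨
    y * β ∸ y′ * β          ≡⟨ *-distribʳ-∸ β y y′ ⟨
    (y ∸ y′) * β            ∎) (≤-<-trans (m∸n≤m x′ x) x′<β)

coefficient-unique : ∀ {α β x y x′ y′} → Coprime α β → x * α + y * β ≡ x′ * α + y′ * β →
                     x < β → x′ < β → x ≡ x′
coefficient-unique {y = y} {y′ = y′} coprime eq x<β x′<β with ≤-total _ _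
... | inj₁ x≤x′ = coefficient-unique-≤ {y = y} {y′ = y′} coprime eq x≤x′ x′<β
... | inj₂ x′≤x = sym (coefficient-unique-≤ {y = y′} {y′ = y} coprime (sym eq) x′≤x x<β)

module Representation (α β : ℕ) (1≤α : 1 ≤ α) (1≤β : 1 ≤ β) (coprime : Coprime α β) where

  instance
    α-nonZero : NonZero α
    α-nonZero = >-nonZero 1≤α
    β-nonZero : NonZero β
    β-nonZero = >-nonZero 1≤β

  infix 4 _≡αβ−⟨_,_⟩

  -- n ≡αβ−⟨ x , y ⟩ says that n = αβ − xα − yβ; lemma names call n "reflected" by (x, y).

  _≡αβ−⟨_,_⟩ : ℕ → ℕ → ℕ → Set
  n ≡αβ−⟨ x , y ⟩ = n + x * α + y * β ≡ α * β

  αβ-decomposition : ∀ u v → u * α + v * β ≡ α * β → u ≡ 0 ⊎ v ≡ 0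
  αβ-decomposition u zero    _   = inj₂ refl
  αβ-decomposition u (suc v) eq = inj₁ (m*n≡0⇒m≡0 u α uα≡0)
    where
    α∣1+v : α ∣ suc v
    α∣1+v = coprime-divisor coprime (subst (α ∣_) (*-comm (suc v) β)
              (∣m+n∣m⇒∣n (subst (α ∣_) (sym eq) (divides β (*-comm α β))) (divides u refl)))
    uα≡0 : u * α ≡ 0
    uα≡0 = n≤0⇒n≡0 (+-cancelʳ-≤ (α * β) (u * α) 0 (begin
      u * α + α * β     ≤⟨ +-monoʳ-≤ (u * α) (*-monoˡ-≤ β (∣⇒≤ α∣1+v)) ⟩
      u * α + suc v * β ≡⟨ eq ⟩
      α * β             ∎))
      where open ≤-Reasoning

  reflected⇒gap : ∀ {n x y} → 1 ≤ x → 1 ≤ y → n ≡αβ−⟨ x , y ⟩ → inΓ α β n ≡ false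
  reflected⇒gap {n} {x} {y} 1≤x 1≤y reflected = ¬-not n∉Γ
    where
    n∉Γ : inΓ α β n ≢ true
    n∉Γ n∈Γ with a , b , aα+bβ≡n ← inΓ-sound α β n n∈Γ
      with αβ-decomposition (a + x) (b + y) (begin
        (a + x) * α + (b + y) * β   ≡⟨ collect a b x y α β ⟩
        a * α + b * β + x * α + y * β ≡⟨ cong (λ m → m + x * α + y * β) aα+bβ≡n ⟩
        n + x * α + y * β           ≡⟨ reflected ⟩
        α * β                       ∎)
      where
      open ≡-Reasoning
      collect : ∀ a b x y α β → (a + x) * α + (b + y) * β ≡ a * α + b * β + x * α + y * β
      collect = solve-∀
    ... | inj₁ a+x≡0 = <⇒≢ (≤-trans 1≤x (m≤n+m x a)) (sym a+x≡0)
    ... | inj₂ b+y≡0 = <⇒≢ (≤-trans 1≤y (m≤n+m y b)) (sym b+y≡0)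

  reflected-cancel : ∀ {n x y x′ y′} → n ≡αβ−⟨ x , y ⟩ → n ≡αβ−⟨ x′ , y′ ⟩ →
                     x * α + y * β ≡ x′ * α + y′ * β
  reflected-cancel {n} {x} {y} {x′} {y′} r r′ =
    +-cancelˡ-≡ n _ _ (trans (sym (+-assoc n (x * α) (y * β))) (trans (trans r (sym r′)) (+-assoc n (x′ * α) (y′ * β))))

  reflected-injective : ∀ {n m x y} → n ≡αβ−⟨ x , y ⟩ → m ≡αβ−⟨ x , y ⟩ → n ≡ m
  reflected-injective {n} {m} {x} {y} r r′ =
    +-cancelʳ-≡ (x * α + y * β) n m (trans (sym (+-assoc n (x * α) (y * β))) (trans (trans r (sym r′)) (+-assoc m (x * α) (y * β))))

  α-coefficient<β : ∀ {n x y} → 1 ≤ y → n ≡αβ−⟨ x , y ⟩ → x < β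
  α-coefficient<β {n} {x} {y} 1≤y reflected = *-cancelʳ-< α x β (begin-strict
    x * α               ≤⟨ m≤n+m (x * α) n ⟩
    n + x * α           <⟨ m<m+n (n + x * α) (*-mono-≤ 1≤y 1≤β) ⟩
    n + x * α + y * β   ≡⟨ reflected ⟩
    α * β               ≡⟨ *-comm α β ⟩
    β * α               ∎)
    where open ≤-Reasoning

  β-coefficient<α : ∀ {n x y} → 1 ≤ x → n ≡αβ−⟨ x , y ⟩ → y < α
  β-coefficient<α {n} {x} {y} 1≤x reflected = *-cancelʳ-< β y α (begin-strict
    y * β               <⟨ m<n+m (y * β) (≤-trans (*-mono-≤ 1≤x 1≤α) (m≤n+m (x * α) n)) ⟩
    n + x * α + y * β   ≡⟨ reflected ⟩
    α * β               ∎)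
    where open ≤-Reasoning

  reflected-positive : ∀ {n x y} → 1 ≤ x → 1 ≤ y → n ≡αβ−⟨ x , y ⟩ → 1 ≤ n
  reflected-positive {zero} 1≤x 1≤y r
    with () ← trans (sym (inΓ-complete {n = 0} 0 0 1≤α 1≤β refl)) (reflected⇒gap {n = 0} 1≤x 1≤y r)
  reflected-positive {suc n} _ _ _ = s≤s z≤n

  β-coefficient-cancel : ∀ {x y y′} → x * α + y * β ≡ x * α + y′ * β → y ≡ y′
  β-coefficient-cancel {x} {y} {y′} eq = *-cancelʳ-≡ y y′ β (+-cancelˡ-≡ (x * α) _ _ eq)

  representation-unique : ∀ {u v p q} → u * α + v * β ≡ p * α + q * β → p < β → q < α → u ≡ p × v ≡ q
  representation-unique {u} {v} {p} {q} eq p<β q<α with u ≤? p | v ≤? q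
  ... | yes u≤p | _ = u≡p , *-cancelʳ-≡ v q β (+-cancelˡ-≡ (p * α) _ _ (trans (cong (λ z → z * α + v * β) (sym u≡p)) eq))
    where
    u≡p : u ≡ p
    u≡p = coefficient-unique {y = v} {y′ = q} coprime eq (≤-<-trans u≤p p<β) p<β
  ... | no _ | yes v≤q = *-cancelʳ-≡ u p α (+-cancelʳ-≡ (q * β) _ _ (trans (cong (λ z → u * α + z * β) (sym v≡q)) eq)) , v≡q
    where
    v≡q : v ≡ q
    v≡q = coefficient-unique {y = u} {y′ = p} (Coprime.sym coprime)
            (trans (+-comm (v * β) (u * α)) (trans eq (+-comm (p * α) (q * β)))) (≤-<-trans v≤q q<α) q<α
  ... | no u≰p | no v≰q = ⊥-elim (<⇒≢ (+-mono-< (*-monoˡ-< α (≰⇒> u≰p)) (*-monoˡ-< β (≰⇒> v≰q))) (sym eq))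

  residue-representation : ∀ n → ∃₂ λ s m → s < α × (s * β + m * α ≡ n ⊎ s * β ≡ n + suc m * α)
  residue-representation n with u , v , inverse ← coprime-inverse 1≤β coprime = split (n * v ≤? t * β)
    where
    open ≡-Reasoning
    s = (n * u) % α
    t = (n * u) / α
    sβ+tβα≡n+nvα : s * β + t * β * α ≡ n + n * v * α
    sβ+tβα≡n+nvα = begin
      s * β + t * β * α ≡⟨ ring₁ s t α β ⟩
      (s + t * α) * β   ≡⟨ cong (_* β) (m≡m%n+[m/n]*n (n * u) α) ⟨
      n * u * β         ≡⟨ *-assoc n u β ⟩
      n * (u * β)       ≡⟨ cong (n *_) inverse ⟨
      n * (1 + v * α)   ≡⟨ ring₂ n v α ⟩
      n + n * v * α     ∎
      where
      ring₁ : ∀ s t α β → s * β + t * β * α ≡ (s + t * α) * β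
      ring₁ = solve-∀
      ring₂ : ∀ n v α → n * (1 + v * α) ≡ n + n * v * α
      ring₂ = solve-∀
    split : Dec (n * v ≤ t * β) → ∃₂ λ s m → s < α × (s * β + m * α ≡ n ⊎ s * β ≡ n + suc m * α)
    split (yes nv≤tβ) = s , m , m%n<n (n * u) α , inj₁ (+-cancelʳ-≡ (n * v * α) _ _ (begin
      s * β + m * α + n * v * α ≡⟨ ring s m (n * v) α β ⟩
      s * β + (m + n * v) * α   ≡⟨ cong (λ k → s * β + k * α) (m∸n+n≡m nv≤tβ) ⟩
      s * β + t * β * α         ≡⟨ sβ+tβα≡n+nvα ⟩
      n + n * v * α             ∎))
      where
      m = t * β ∸ n * v
      ring : ∀ s m k α β → s * β + m * α + k * α ≡ s * β + (m + k) * α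
      ring = solve-∀
    split (no nv≰tβ) = s , m , m%n<n (n * u) α , inj₂ (+-cancelʳ-≡ (t * β * α) _ _ (begin
      s * β + t * β * α          ≡⟨ sβ+tβα≡n+nvα ⟩
      n + n * v * α              ≡⟨ cong (λ k → n + k * α) (m+[n∸m]≡n (≰⇒> nv≰tβ)) ⟨
      n + (suc (t * β) + m) * α  ≡⟨ ring n (t * β) m α ⟩
      n + suc m * α + t * β * α  ∎))
      where
      m = n * v ∸ suc (t * β)
      ring : ∀ n k m α → n + (suc k + m) * α ≡ n + suc m * α + k * α
      ring = solve-∀

  gap⇒reflected : ∀ {n} → inΓ α β n ≡ false → ∃₂ λ x y → 1 ≤ x × 1 ≤ y × n ≡αβ−⟨ x , y ⟩
  gap⇒reflected {n} n∉Γ with residue-representation n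
  ... | s , m , _   , inj₁ sβ+mα≡n with () ← trans (sym (inΓ-complete m s 1≤α 1≤β (trans (+-comm (m * α) (s * β)) sβ+mα≡n))) n∉Γ
  ... | s , m , s<α , inj₂ sβ≡n+[1+m]α = suc m , α ∸ s , s≤s z≤n , m<n⇒0<n∸m s<α , (begin
    n + suc m * α + (α ∸ s) * β ≡⟨ cong (_+ (α ∸ s) * β) sβ≡n+[1+m]α ⟨
    s * β + (α ∸ s) * β         ≡⟨ *-distribʳ-+ β s (α ∸ s) ⟨
    (s + (α ∸ s)) * β           ≡⟨ cong (_* β) (m+[n∸m]≡n (<⇒≤ s<α)) ⟩
    α * β                       ∎)
    where open ≡-Reasoning

conductor-identity : ∀ α β → 1 ≤ α → 1 ≤ β → (α ∸ 1) * (β ∸ 1) + α + β ≡ α * β + 1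
conductor-identity (suc a) (suc b) _ _ = ring a b
  where
  ring : ∀ a b → a * b + suc a + suc b ≡ suc a * suc b + 1
  ring = solve-∀

doubling-balance : ∀ {d e a b c} → d + a ≡ e + b → e + e ≡ c + a → 2 * d + a ≡ c + 2 * b
doubling-balance {d} {e} {a} {b} {c} d+a≡e+b e+e≡c+a = +-cancelʳ-≡ a _ _ (begin
  2 * d + a + a           ≡⟨ ring₁ d a ⟩
  (d + a) + (d + a)       ≡⟨ cong (λ k → k + k) d+a≡e+b ⟩
  (e + b) + (e + b)       ≡⟨ ring₂ e b ⟩
  (e + e) + 2 * b         ≡⟨ cong (_+ 2 * b) e+e≡c+a ⟩
  c + a + 2 * b           ≡⟨ ring₃ c a b ⟩
  c + 2 * b + a           ∎)
  where
  open ≡-Reasoning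
  ring₁ : ∀ d a → 2 * d + a + a ≡ (d + a) + (d + a)
  ring₁ = solve-∀
  ring₂ : ∀ e b → (e + b) + (e + b) ≡ (e + e) + 2 * b
  ring₂ = solve-∀
  ring₃ : ∀ c a b → c + a + 2 * b ≡ c + 2 * b + a
  ring₃ = solve-∀

4ab≤[a+b]² : ∀ a b → 4 * (a * b) ≤ (a + b) * (a + b)
4ab≤[a+b]² a b with ≤-total a b
... | inj₁ a≤b = subst (λ z → 4 * (a * z) ≤ (a + z) * (a + z)) (m+[n∸m]≡n a≤b)
                   (≤-trans (m≤m+n _ _) (≤-reflexive (ring a (b ∸ a))))
  where
  ring : ∀ a k → 4 * (a * (a + k)) + k * k ≡ (a + (a + k)) * (a + (a + k))
  ring = solve-∀
... | inj₂ b≤a = subst (λ z → 4 * (z * b) ≤ (z + b) * (z + b)) (m+[n∸m]≡n b≤a)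
                   (≤-trans (m≤m+n _ _) (≤-reflexive (ring b (a ∸ b))))
  where
  ring : ∀ b k → 4 * ((b + k) * b) + k * k ≡ ((b + k) + b) * ((b + k) + b)
  ring = solve-∀

αβ≤4[α-1][β-1] : ∀ α β → 2 ≤ α → 2 ≤ β → α * β ≤ 4 * ((α ∸ 1) * (β ∸ 1))
αβ≤4[α-1][β-1] (suc (suc a)) (suc (suc b)) _ _ = ≤-trans (m≤m+n _ (2 * a + 2 * b + 3 * (a * b))) (≤-reflexive (ring a b))
  where
  ring : ∀ a b → suc (suc a) * suc (suc b) + (2 * a + 2 * b + 3 * (a * b)) ≡ 4 * (suc a * suc b)
  ring = solve-∀
αβ≤4[α-1][β-1] (suc zero) _ (s≤s ()) _
αβ≤4[α-1][β-1] (suc (suc _)) (suc zero) _ (s≤s ())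

-- With α = 2q′ + d, AM-GM gives 8 q′ d ≤ α², so p α < q′ β turns into 8 p d α < α² β.
excess-bound : ∀ {α β p q′ d} → 1 ≤ d → 2 * q′ + d ≡ α → p * α < q′ * β → 8 * (p * d) < α * β
excess-bound {α} {β} {p} {q′} {d} 1≤d 2q′+d≡α pα<q′β = *-cancelʳ-< α (8 * (p * d)) (α * β) (begin-strict
  8 * (p * d) * α         ≡⟨ ring₁ p d α ⟩
  (8 * d) * (p * α)       <⟨ *-monoʳ-< (8 * d) {{>-nonZero (*-mono-≤ {1} {8} (s≤s z≤n) 1≤d)}} pα<q′β ⟩
  (8 * d) * (q′ * β)      ≡⟨ ring₂ d q′ β ⟩
  4 * (2 * q′ * d) * β    ≤⟨ *-monoˡ-≤ β (4ab≤[a+b]² (2 * q′) d) ⟩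
  (2 * q′ + d) * (2 * q′ + d) * β ≡⟨ cong (λ a → a * a * β) 2q′+d≡α ⟩
  α * α * β               ≡⟨ ring₃ α β ⟩
  α * β * α               ∎)
  where
  open ≤-Reasoning
  ring₁ : ∀ p d α → 8 * (p * d) * α ≡ (8 * d) * (p * α)
  ring₁ = solve-∀
  ring₂ : ∀ d q′ β → (8 * d) * (q′ * β) ≡ 4 * (2 * q′ * d) * β
  ring₂ = solve-∀
  ring₃ : ∀ α β → α * α * β ≡ α * β * α
  ring₃ = solve-∀

-- d stands for δ(Γ).
record Balanced (α β d g : ℕ) : Set where
  field
    partner     : ℕ
    partner-gap : Gap α β partner
    W-partner   : ∀ {c c′} → IsConductor (inΔ α β g) c → IsConductor (inΔ α β partner) c′ →
                  W α β partner c′ ≡ ℤ.- W α β g c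
    W<δ         : ∀ {c} → IsConductor (inΔ α β g) c → W α β g c ℤ.< ℤ.+ d

module TwoGenerated (α β : ℕ) (2≤α : 2 ≤ α) (2≤β : 2 ≤ β) (coprime : Coprime α β) where

  1≤α : 1 ≤ α
  1≤α = <⇒≤ 2≤α

  1≤β : 1 ≤ β
  1≤β = <⇒≤ 2≤β

  open Representation α β 1≤α 1≤β coprime public

  C : ℕ
  C = (α ∸ 1) * (β ∸ 1)

  reflected<C : ∀ {n x y} → 1 ≤ x → 1 ≤ y → n ≡αβ−⟨ x , y ⟩ → n < C
  reflected<C {n} {x} {y} 1≤x 1≤y reflected = +-cancelʳ-< (α + β) n C (begin-strict
    n + (α + β)         ≤⟨ +-monoʳ-≤ n (+-mono-≤ (m≤n*m α x {{>-nonZero 1≤x}}) (m≤n*m β y {{>-nonZero 1≤y}})) ⟩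
    n + (x * α + y * β) ≡⟨ +-assoc n (x * α) (y * β) ⟨
    n + x * α + y * β   ≡⟨ reflected ⟩
    α * β               <⟨ m<m+n (α * β) z<s ⟩
    α * β + 1           ≡⟨ conductor-identity α β 1≤α 1≤β ⟨
    C + α + β           ≡⟨ +-assoc C α β ⟩
    C + (α + β)         ∎)
    where open ≤-Reasoning

  gap<C : ∀ {n} → inΓ α β n ≡ false → n < C
  gap<C {n} n∉Γ with _ , _ , 1≤x , 1≤y , reflected ← gap⇒reflected {n} n∉Γ = reflected<C 1≤x 1≤y reflected

  Γ-conductor : IsConductor (inΓ α β) C
  Γ-conductor = (λ n C≤n → ¬-not (λ n∉Γ → <⇒≱ (gap<C {n} n∉Γ) C≤n)) , lastGap
    where
    lastGap : ∀ k → C ≡ suc k → inΓ α β k ≡ false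
    lastGap k C≡1+k = reflected⇒gap {n = k} {x = 1} {y = 1} ≤-refl ≤-refl (+-cancelʳ-≡ 1 _ _ (begin
      k + 1 * α + 1 * β + 1 ≡⟨ ring k α β ⟩
      suc k + α + β         ≡⟨ cong (λ c → c + α + β) C≡1+k ⟨
      C + α + β             ≡⟨ conductor-identity α β 1≤α 1≤β ⟩
      α * β + 1             ∎))
      where
      open ≡-Reasoning
      ring : ∀ k α β → k + 1 * α + 1 * β + 1 ≡ suc k + α + β
      ring = solve-∀

  mirror-identity : ∀ {n} → n < C → C ∸ suc n + n + α + β ≡ α * β
  mirror-identity {n} n<C = +-cancelʳ-≡ 1 _ _ (begin
    C ∸ suc n + n + α + β + 1   ≡⟨ ring (C ∸ suc n) n α β ⟩
    C ∸ suc n + suc n + α + β   ≡⟨ cong (λ c → c + α + β) (m∸n+n≡m n<C) ⟩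
    C + α + β                   ≡⟨ conductor-identity α β 1≤α 1≤β ⟩
    α * β + 1                   ∎)
    where
    open ≡-Reasoning
    ring : ∀ m n α β → m + n + α + β + 1 ≡ m + suc n + α + β
    ring = solve-∀

  Γ-symmetric : ∀ n → n < C → inΓ α β n ≡ not (inΓ α β (C ∸ suc n))
  Γ-symmetric n n<C with inΓ α β n in n∈Γ?
  ... | true with a , b , aα+bβ≡n ← inΓ-sound α β n n∈Γ? =
    sym (cong not (reflected⇒gap {n = m} {x = suc a} {y = suc b} (s≤s z≤n) (s≤s z≤n) (begin
      m + suc a * α + suc b * β ≡⟨ ring m a b α β ⟩
      m + (a * α + b * β) + α + β ≡⟨ cong (λ k → m + k + α + β) aα+bβ≡n ⟩
      m + n + α + β             ≡⟨ mirror-identity n<C ⟩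
      α * β                     ∎)))
    where
    open ≡-Reasoning
    m = C ∸ suc n
    ring : ∀ m a b α β → m + suc a * α + suc b * β ≡ m + (a * α + b * β) + α + β
    ring = solve-∀
  ... | false with suc x , suc y , _ , _ , reflected ← gap⇒reflected {n} n∈Γ? =
    sym (cong not (inΓ-complete {n = m} x y 1≤α 1≤β (+-cancelʳ-≡ (n + α + β) _ _ (begin
      x * α + y * β + (n + α + β) ≡⟨ ring₁ n x y α β ⟩
      n + suc x * α + suc y * β   ≡⟨ reflected ⟩
      α * β                       ≡⟨ mirror-identity n<C ⟨
      m + n + α + β               ≡⟨ ring₂ m n α β ⟩
      m + (n + α + β)             ∎))))
    where
    open ≡-Reasoning
    m = C ∸ suc n
    ring₁ : ∀ n x y α β → x * α + y * β + (n + α + β) ≡ n + suc x * α + suc y * β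
    ring₁ = solve-∀
    ring₂ : ∀ m n α β → m + n + α + β ≡ m + (n + α + β)
    ring₂ = solve-∀

  δΓ : ℕ
  δΓ = δ (inΓ α β) C

  δΓ+δΓ≡C : δΓ + δΓ ≡ C
  δΓ+δΓ≡C = countBelow-self-dual (inΓ α β) C Γ-symmetric

  InBox : ℕ → ℕ → ℕ → Set
  InBox p q n = ∃₂ λ x y → 1 ≤ x × x ≤ p × 1 ≤ y × y ≤ q × n ≡αβ−⟨ x , y ⟩

  column : ℕ → ℕ → ℕ → Bool
  column x zero    n = false
  column x (suc q) n = column x q n ∨ (n + x * α + suc q * β ≡ᵇ α * β)

  box : ℕ → ℕ → ℕ → Bool
  box zero    q n = false
  box (suc p) q n = box p q n ∨ column (suc p) q n

  column-sound : ∀ x q n → column x q n ≡ true → ∃ λ y → 1 ≤ y × y ≤ q × n ≡αβ−⟨ x , y ⟩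
  column-sound x (suc q) n e with ∨-true⁻ (column x q n) e
  ... | inj₁ e′ with y , 1≤y , y≤q , r ← column-sound x q n e′ = y , 1≤y , m≤n⇒m≤1+n y≤q , r
  ... | inj₂ e′ = suc q , s≤s z≤n , ≤-refl , ≡ᵇ-true⁻ _ (α * β) e′

  column-complete : ∀ {x q n y} → 1 ≤ y → y ≤ q → n ≡αβ−⟨ x , y ⟩ → column x q n ≡ true
  column-complete {q = zero} (s≤s _) () _
  column-complete {x} {suc q} {n} 1≤y y≤1+q r with m≤n⇒m<n∨m≡n y≤1+q
  ... | inj₁ y≤q  = ∨-trueˡ _ (column-complete 1≤y (s≤s⁻¹ y≤q) r)
  ... | inj₂ refl = ∨-trueʳ (column x q n) (≡ᵇ-true⁺ r)

  box-sound : ∀ p q n → box p q n ≡ true → InBox p q n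
  box-sound (suc p) q n e with ∨-true⁻ (box p q n) e
  ... | inj₁ e′ with x , y , 1≤x , x≤p , rest ← box-sound p q n e′ = x , y , 1≤x , m≤n⇒m≤1+n x≤p , rest
  ... | inj₂ e′ with y , 1≤y , y≤q , r ← column-sound (suc p) q n e′ = suc p , y , s≤s z≤n , ≤-refl , 1≤y , y≤q , r

  box-complete : ∀ {p q n} → InBox p q n → box p q n ≡ true
  box-complete {zero} (_ , _ , s≤s _ , () , _)
  box-complete {suc p} {q} {n} (x , y , 1≤x , x≤1+p , 1≤y , y≤q , r) with m≤n⇒m<n∨m≡n x≤1+p
  ... | inj₁ x≤p  = ∨-trueˡ _ (box-complete (x , y , 1≤x , s≤s⁻¹ x≤p , 1≤y , y≤q , r))
  ... | inj₂ refl = ∨-trueʳ (box p q n) (column-complete 1≤y y≤q r)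

  column-count : ∀ x q → 1 ≤ x → x * α + q * β ≤ α * β → countBelow (column x q) C ≡ q
  column-count x zero    _   _     = countBelow-empty _ C (λ _ _ → refl)
  column-count x (suc q) 1≤x fits = begin
    countBelow (λ n → column x q n ∨ new n) C        ≡⟨ countBelow-∨ (column x q) new C disjoint ⟩
    countBelow (column x q) C + countBelow new C   ≡⟨ cong₂ _+_ (column-count x q 1≤x fits′) single ⟩
    q + 1                                          ≡⟨ +-comm q 1 ⟩
    suc q                                          ∎
    where
    open ≡-Reasoning
    new : ℕ → Bool
    new n = n + x * α + suc q * β ≡ᵇ α * β
    fits′ : x * α + q * β ≤ α * β
    fits′ = ≤-trans (+-monoʳ-≤ (x * α) (*-monoˡ-≤ β (n≤1+n q))) fits
    disjoint : ∀ n → column x q n ≡ true → new n ≡ false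
    disjoint n e with y , _ , y≤q , r ← column-sound x q n e =
      ¬-not (λ e′ → <⇒≢ (s≤s y≤q)
        (β-coefficient-cancel {x} (reflected-cancel {n} {x} {y} {x} {suc q} r (≡ᵇ-true⁻ _ (α * β) e′))))
    k = α * β ∸ (x * α + suc q * β)
    k-reflected : k ≡αβ−⟨ x , suc q ⟩
    k-reflected = trans (+-assoc k _ _) (m∸n+n≡m fits)
    single : countBelow new C ≡ 1
    single = countBelow-singleton new k C (reflected<C {k} {x} {suc q} 1≤x (s≤s z≤n) k-reflected) (≡ᵇ-true⁺ k-reflected)
      (λ n e → reflected-injective {n} {k} {x} {suc q} (≡ᵇ-true⁻ (n + x * α + suc q * β) (α * β) e) k-reflected)

  box-count : ∀ p q → p < β → p * α + q * β ≤ α * β → countBelow (box p q) C ≡ p * q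
  box-count zero    q _   _    = countBelow-empty _ C (λ _ _ → refl)
  box-count (suc p) q p<β fits = begin
    countBelow (λ n → box p q n ∨ column (suc p) q n) C        ≡⟨ countBelow-∨ (box p q) (column (suc p) q) C disjoint ⟩
    countBelow (box p q) C + countBelow (column (suc p) q) C
      ≡⟨ cong₂ _+_ (box-count p q (<⇒≤ p<β) fits′) (column-count (suc p) q (s≤s z≤n) fits) ⟩
    p * q + q                                                 ≡⟨ +-comm (p * q) q ⟩
    suc p * q                                                 ∎
    where
    open ≡-Reasoning
    fits′ : p * α + q * β ≤ α * β
    fits′ = ≤-trans (+-monoˡ-≤ (q * β) (*-monoˡ-≤ α (n≤1+n p))) fits
    disjoint : ∀ n → box p q n ≡ true → column (suc p) q n ≡ false
    disjoint n e with x , y , _ , x≤p , _ , _ , r ← box-sound p q n e =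
      ¬-not (λ e′ → let y′ , _ , _ , r′ = column-sound (suc p) q n e′ in
        <⇒≢ (s≤s x≤p) (coefficient-unique {y = y} {y′ = y′} coprime (reflected-cancel {n} {x} {y} {suc p} {y′} r r′)
                                          (≤-<-trans (m≤n⇒m≤1+n x≤p) p<β) p<β))

  module Semimodule {g p q : ℕ} (1≤p : 1 ≤ p) (1≤q : 1 ≤ q) (g-reflected : g ≡αβ−⟨ p , q ⟩) where

    p<β : p < β
    p<β = α-coefficient<β {g} 1≤q g-reflected

    q<α : q < α
    q<α = β-coefficient<α {g} 1≤p g-reflected

    shifted-reflection : ∀ {a b x y} → g + (a * α + b * β) ≡αβ−⟨ x , y ⟩ → (a + x) * α + (b + y) * β ≡ p * α + q * β
    shifted-reflection {a} {b} {x} {y} r = +-cancelˡ-≡ g _ _ (begin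
      g + ((a + x) * α + (b + y) * β)     ≡⟨ ring g a b x y α β ⟩
      g + (a * α + b * β) + x * α + y * β ≡⟨ r ⟩
      α * β                               ≡⟨ g-reflected ⟨
      g + p * α + q * β                   ≡⟨ +-assoc g (p * α) (q * β) ⟩
      g + (p * α + q * β)                 ∎)
      where
      open ≡-Reasoning
      ring : ∀ g a b x y α β → g + ((a + x) * α + (b + y) * β) ≡ g + (a * α + b * β) + x * α + y * β
      ring = solve-∀

    shifted-gap⇒box : ∀ n → inΓ α β n ≡ false → inShift α β g n ≡ true → box p q n ≡ true
    shifted-gap⇒box n n∉Γ n∈g+Γ
      with m , refl , m∈Γ ← inShift-sound α β g n n∈g+Γ
      with a , b , refl ← inΓ-sound α β m m∈Γ
      with x , y , 1≤x , 1≤y , r ← gap⇒reflected {n} n∉Γ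
      with a+x≡p , b+y≡q ← representation-unique {a + x} {b + y} {p} {q} (shifted-reflection {a} {b} r) p<β q<α
      = box-complete (x , y , 1≤x , subst (x ≤_) a+x≡p (m≤n+m x a) , 1≤y , subst (y ≤_) b+y≡q (m≤n+m y b) , r)

    box⇒shifted : ∀ n → box p q n ≡ true → inShift α β g n ≡ true
    box⇒shifted n n∈box with x , y , _ , x≤p , _ , y≤q , r ← box-sound p q n n∈box =
      subst (λ k → inShift α β g k ≡ true) (sym n≡g+m) (inShift-complete α β g m (inΓ-complete (p ∸ x) (q ∸ y) 1≤α 1≤β refl))
      where
      open ≡-Reasoning
      m = (p ∸ x) * α + (q ∸ y) * β
      n≡g+m : n ≡ g + m
      n≡g+m = +-cancelʳ-≡ (x * α + y * β) n (g + m) (begin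
        n + (x * α + y * β)           ≡⟨ +-assoc n (x * α) (y * β) ⟨
        n + x * α + y * β             ≡⟨ r ⟩
        α * β                         ≡⟨ g-reflected ⟨
        g + p * α + q * β             ≡⟨ cong₂ (λ u v → g + u * α + v * β) (m∸n+n≡m x≤p) (m∸n+n≡m y≤q) ⟨
        g + (p ∸ x + x) * α + (q ∸ y + y) * β ≡⟨ ring g (p ∸ x) x (q ∸ y) y α β ⟩
        g + m + (x * α + y * β)       ∎)
        where
        ring : ∀ g u x v y α β → g + (u + x) * α + (v + y) * β ≡ g + (u * α + v * β) + (x * α + y * β)
        ring = solve-∀

    Δ≡Γ∨box : ∀ n → inΔ α β g n ≡ inΓ α β n ∨ box p q n
    Δ≡Γ∨box n with inΓ α β n in n∈Γ?
    ... | true  = refl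
    ... | false = Bool-ext (shifted-gap⇒box n n∈Γ?) (box⇒shifted n)

    Δ-count : countBelow (inΔ α β g) C ≡ δΓ + p * q
    Δ-count = begin
      countBelow (inΔ α β g) C                          ≡⟨ countBelow-cong _ _ C (λ n _ → Δ≡Γ∨box n) ⟩
      countBelow (λ n → inΓ α β n ∨ box p q n) C        ≡⟨ countBelow-∨ (inΓ α β) (box p q) C disjoint ⟩
      δΓ + countBelow (box p q) C                       ≡⟨ cong (δΓ +_) (box-count p q p<β fits) ⟩
      δΓ + p * q                                        ∎
      where
      open ≡-Reasoning
      fits : p * α + q * β ≤ α * β
      fits = ≤-trans (m≤n+m _ g) (≤-reflexive (trans (sym (+-assoc g _ _)) g-reflected))
      disjoint : ∀ n → inΓ α β n ≡ true → box p q n ≡ false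
      disjoint n n∈Γ = ¬-not λ n∈box → let x , y , 1≤x , _ , 1≤y , _ , r = box-sound p q n n∈box in
        case trans (sym n∈Γ) (reflected⇒gap {n} 1≤x 1≤y r) of λ ()

    module Lower (pα<qβ : p * α < q * β) where

      K : ℕ
      K = suc p * α + β

      K≤outside : ∀ {x y} → 1 ≤ x → 1 ≤ y → p < x ⊎ q < y → K ≤ x * α + y * β
      K≤outside {x} {y} 1≤x 1≤y (inj₁ p<x) = +-mono-≤ (*-monoˡ-≤ α p<x) (m≤n*m β y {{>-nonZero 1≤y}})
      K≤outside {x} {y} 1≤x 1≤y (inj₂ q<y) = begin
        α + p * α + β     ≤⟨ +-monoˡ-≤ β (+-monoʳ-≤ α (<⇒≤ pα<qβ)) ⟩
        α + q * β + β     ≡⟨ ring α q β ⟩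
        α + suc q * β     ≤⟨ +-mono-≤ (m≤n*m α x {{>-nonZero 1≤x}}) (*-monoˡ-≤ β q<y) ⟩
        x * α + y * β     ∎
        where
        open ≤-Reasoning
        ring : ∀ α q β → α + q * β + β ≡ α + suc q * β
        ring = solve-∀

      Δ-full : ∀ n → α * β < n + K → inΔ α β g n ≡ true
      Δ-full n αβ<n+K rewrite Δ≡Γ∨box n with inΓ α β n in n∈Γ?
      ... | true  = refl
      ... | false with x , y , 1≤x , 1≤y , r ← gap⇒reflected {n} n∈Γ? with x ≤? p | y ≤? q
      ...   | yes x≤p | yes y≤q = box-complete (x , y , 1≤x , x≤p , 1≤y , y≤q , r)
      ...   | no  x≰p | _       = ⊥-elim (<⇒≱ αβ<n+K (outside (inj₁ (≰⇒> x≰p))))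
        where
        outside : p < x ⊎ q < y → n + K ≤ α * β
        outside out = ≤-trans (+-monoʳ-≤ n (K≤outside 1≤x 1≤y out)) (≤-reflexive (trans (sym (+-assoc n _ _)) r))
      ...   | yes _   | no  y≰q = ⊥-elim (<⇒≱ αβ<n+K (outside (inj₂ (≰⇒> y≰q))))
        where
        outside : p < x ⊎ q < y → n + K ≤ α * β
        outside out = ≤-trans (+-monoʳ-≤ n (K≤outside 1≤x 1≤y out)) (≤-reflexive (trans (sym (+-assoc n _ _)) r))

      Δ-conductor-0 : α * β < K → IsConductor (inΔ α β g) 0
      Δ-conductor-0 αβ<K = (λ n _ → Δ-full n (<-≤-trans αβ<K (m≤n+m K n))) , λ _ ()

      W≡0 : α * β < K → ∀ {c} → IsConductor (inΔ α β g) c → W α β g c ≡ ℤ.+ 0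
      W≡0 αβ<K cond rewrite conductor-unique cond (Δ-conductor-0 αβ<K) = refl

      module Proper (K≤αβ : K ≤ α * β) where

        c₀ : ℕ
        c₀ = α * β ∸ K

        c₀-reflected : c₀ ≡αβ−⟨ suc p , 1 ⟩
        c₀-reflected = trans (ring c₀ p α β) (m∸n+n≡m K≤αβ)
          where
          ring : ∀ c p α β → c + suc p * α + 1 * β ≡ c + (suc p * α + β)
          ring = solve-∀

        Δ-conductor : IsConductor (inΔ α β g) (suc c₀)
        Δ-conductor = full , lastGap
          where
          full : ∀ n → suc c₀ ≤ n → inΔ α β g n ≡ true
          full n c₀<n = Δ-full n (≤-trans (≤-reflexive (sym (cong suc (m∸n+n≡m K≤αβ)))) (+-monoˡ-≤ K c₀<n))
          c₀∉box : box p q c₀ ≡ false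
          c₀∉box = ¬-not λ c₀∈box →
            let x , y , _ , x≤p , _ , _ , r = box-sound p q c₀ c₀∈box in
            <⇒≢ (s≤s x≤p) (coefficient-unique {y = y} {y′ = 1} coprime (reflected-cancel {c₀} {x} {y} {suc p} {1} r c₀-reflected)
                             (≤-<-trans (m≤n⇒m≤1+n x≤p) 1+p<β) 1+p<β)
            where
            1+p<β : suc p < β
            1+p<β = α-coefficient<β {c₀} ≤-refl c₀-reflected
          lastGap : ∀ k → suc c₀ ≡ suc k → inΔ α β g k ≡ false
          lastGap k refl =
            trans (Δ≡Γ∨box c₀) (cong₂ _∨_ (reflected⇒gap {c₀} {suc p} {1} (s≤s z≤n) ≤-refl c₀-reflected) c₀∉box)

        C≡1+c₀+pα : C ≡ suc c₀ + p * α
        C≡1+c₀+pα = +-cancelʳ-≡ (α + β) _ _ (begin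
          C + (α + β)             ≡⟨ +-assoc C α β ⟨
          C + α + β               ≡⟨ conductor-identity α β 1≤α 1≤β ⟩
          α * β + 1               ≡⟨ cong (_+ 1) (m∸n+n≡m K≤αβ) ⟨
          c₀ + K + 1              ≡⟨ ring c₀ p α β ⟩
          suc c₀ + p * α + (α + β) ∎)
          where
          open ≡-Reasoning
          ring : ∀ c p α β → c + (suc p * α + β) + 1 ≡ suc c + p * α + (α + β)
          ring = solve-∀

        W≡ : ∀ {c} → IsConductor (inΔ α β g) c → W α β g c ≡ 2 * (p * q) ⊖ p * α
        W≡ cond rewrite conductor-unique cond Δ-conductor = begin
          ℤ.+ (2 * δΔ) ℤ.- ℤ.+ suc c₀ ≡⟨ ℤ.m-n≡m⊖n (2 * δΔ) (suc c₀) ⟩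
          2 * δΔ ⊖ suc c₀
            ≡⟨ ⊖-cross {2 * δΔ} {2 * (p * q)} {suc c₀} {p * α} (doubling-balance {δΔ} {δΓ} δΔ+pα≡δΓ+pq δΓ+δΓ≡1+c₀+pα) ⟩
          2 * (p * q) ⊖ p * α          ∎
          where
          open ≡-Reasoning
          δΔ = countBelow (inΔ α β g) (suc c₀)
          δΔ+pα≡δΓ+pq : δΔ + p * α ≡ δΓ + p * q
          δΔ+pα≡δΓ+pq = begin
            δΔ + p * α                          ≡⟨ countBelow-full-interval (inΔ α β g) (suc c₀) (p * α) (proj₁ Δ-conductor) ⟨
            countBelow (inΔ α β g) (suc c₀ + p * α) ≡⟨ cong (countBelow (inΔ α β g)) C≡1+c₀+pα ⟨
            countBelow (inΔ α β g) C            ≡⟨ Δ-count ⟩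
            δΓ + p * q                          ∎
          δΓ+δΓ≡1+c₀+pα : δΓ + δΓ ≡ suc c₀ + p * α
          δΓ+δΓ≡1+c₀+pα = trans δΓ+δΓ≡C C≡1+c₀+pα

  δΓ-positive : 1 ≤ δΓ
  δΓ-positive with δΓ | δΓ+δΓ≡C
  ... | suc _ | _ = s≤s z≤n
  ... | zero  | 0≡C = ⊥-elim (<⇒≢ (*-mono-≤ {1} {α ∸ 1} {1} {β ∸ 1} (∸-monoˡ-≤ 1 2≤α) (∸-monoˡ-≤ 1 2≤β)) 0≡C)

  lower-excess<δΓ : ∀ {p q q′} → q + q′ ≡ α → p * α < q′ * β → 2 * (p * q) < δΓ + p * α
  lower-excess<δΓ {p} {q} {q′} q+q′≡α pα<q′β with q ≤? q′
  ... | yes q≤q′ = begin-strict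
    2 * (p * q)   ≡⟨ ring p q ⟩
    p * (q + q)   ≤⟨ *-monoʳ-≤ p (+-monoʳ-≤ q q≤q′) ⟩
    p * (q + q′)  ≡⟨ cong (p *_) q+q′≡α ⟩
    p * α         <⟨ m<n+m (p * α) δΓ-positive ⟩
    δΓ + p * α    ∎
    where
    open ≤-Reasoning
    ring : ∀ p q → 2 * (p * q) ≡ p * (q + q)
    ring = solve-∀
  ... | no q≰q′ = begin-strict
    2 * (p * q)   ≡⟨ cong (λ k → 2 * (p * k)) q≡q′+d ⟩
    2 * (p * (q′ + d)) ≡⟨ ring p q′ d ⟩
    p * (q′ + d + q′) + p * d ≡⟨ cong (λ a → p * a + p * d) α≡q′+d+q′ ⟨
    p * α + p * d <⟨ +-monoʳ-< (p * α) pd<δΓ ⟩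
    p * α + δΓ    ≡⟨ +-comm (p * α) δΓ ⟩
    δΓ + p * α    ∎
    where
    open ≤-Reasoning
    d = q ∸ q′
    q≡q′+d : q ≡ q′ + d
    q≡q′+d = sym (m+[n∸m]≡n (<⇒≤ (≰⇒> q≰q′)))
    α≡q′+d+q′ : α ≡ q′ + d + q′
    α≡q′+d+q′ = trans (sym q+q′≡α) (cong (_+ q′) q≡q′+d)
    ring : ∀ p q′ d → 2 * (p * (q′ + d)) ≡ p * (q′ + d + q′) + p * d
    ring = solve-∀
    pd<δΓ : p * d < δΓ
    pd<δΓ = *-cancelˡ-< 8 (p * d) δΓ (begin-strict
      8 * (p * d)  <⟨ excess-bound {α} {β} {p} {q′} (m<n⇒0<n∸m (≰⇒> q≰q′)) (trans (ring′ q′ d) (sym α≡q′+d+q′)) pα<q′β ⟩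
      α * β        ≤⟨ αβ≤4[α-1][β-1] α β 2≤α 2≤β ⟩
      4 * C        ≡⟨ cong (4 *_) δΓ+δΓ≡C ⟨
      4 * (δΓ + δΓ) ≡⟨ ring″ δΓ ⟩
      8 * δΓ       ∎)
      where
      ring′ : ∀ q′ d → 2 * q′ + d ≡ q′ + d + q′
      ring′ = solve-∀
      ring″ : ∀ x → 4 * (x + x) ≡ 8 * x
      ring″ = solve-∀

  lower-gap-balanced : ∀ {g p q} → 1 ≤ p → 1 ≤ q → g ≡αβ−⟨ p , q ⟩ → p * α < q * β → Balanced α β δΓ g
  lower-gap-balanced {g} {p} {q} 1≤p 1≤q g-reflected pα<qβ = record
    { partner     = g′
    ; partner-gap = reflected⇒gap {g′} {p} {q′} 1≤p 1≤q′ g′-reflected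
    ; W-partner   = W-partner
    ; W<δ         = W<δ
    }
    where
    q<α : q < α
    q<α = Semimodule.q<α 1≤p 1≤q g-reflected
    q′ = α ∸ q
    g′ = q * β ∸ p * α
    q+q′≡α : q + q′ ≡ α
    q+q′≡α = m+[n∸m]≡n (<⇒≤ q<α)
    1≤q′ : 1 ≤ q′
    1≤q′ = m<n⇒0<n∸m q<α
    qβ+q′β≡αβ : q * β + q′ * β ≡ α * β
    qβ+q′β≡αβ = trans (sym (*-distribʳ-+ β q q′)) (cong (_* β) q+q′≡α)
    g′-reflected : g′ ≡αβ−⟨ p , q′ ⟩
    g′-reflected = trans (cong (_+ q′ * β) (m∸n+n≡m (<⇒≤ pα<qβ))) qβ+q′β≡αβ
    pα<q′β : p * α < q′ * β
    pα<q′β = +-cancelʳ-< (q * β) (p * α) (q′ * β) (begin-strict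
      p * α + q * β       <⟨ m<n+m _ (reflected-positive {g} 1≤p 1≤q g-reflected) ⟩
      g + (p * α + q * β) ≡⟨ +-assoc g (p * α) (q * β) ⟨
      g + p * α + q * β   ≡⟨ g-reflected ⟩
      α * β               ≡⟨ qβ+q′β≡αβ ⟨
      q * β + q′ * β      ≡⟨ +-comm (q * β) (q′ * β) ⟩
      q′ * β + q * β      ∎)
      where open ≤-Reasoning
    module L  = Semimodule.Lower 1≤p 1≤q  g-reflected  pα<qβ
    module L′ = Semimodule.Lower 1≤p 1≤q′ g′-reflected pα<q′β
    W-partner : ∀ {c c′} → IsConductor (inΔ α β g) c → IsConductor (inΔ α β g′) c′ → W α β g′ c′ ≡ ℤ.- W α β g c
    W-partner cond cond′ with L.K ≤? α * β
    ... | yes K≤αβ rewrite L.Proper.W≡ K≤αβ cond | L′.Proper.W≡ K≤αβ cond′ =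
      trans (⊖-cross {2 * (p * q′)} {p * α} {p * α} {2 * (p * q)} (trans (ring p q q′) (cong (λ a → p * a + p * a) q+q′≡α)))
            (ℤ.⊖-swap (p * α) (2 * (p * q)))
      where
      ring : ∀ p q q′ → 2 * (p * q′) + 2 * (p * q) ≡ p * (q + q′) + p * (q + q′)
      ring = solve-∀
    ... | no  K≰αβ rewrite L.W≡0 (≰⇒> K≰αβ) cond | L′.W≡0 (≰⇒> K≰αβ) cond′ = refl
    W<δ : ∀ {c} → IsConductor (inΔ α β g) c → W α β g c ℤ.< ℤ.+ δΓ
    W<δ cond with L.K ≤? α * β
    ... | yes K≤αβ rewrite L.Proper.W≡ K≤αβ cond = ⊖<ℤ (lower-excess<δΓ {p} {q} {q′} q+q′≡α pα<q′β)
    ... | no  K≰αβ rewrite L.W≡0 (≰⇒> K≰αβ) cond = ℤ.+<+ δΓ-positive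

Balanced-comm : ∀ {α β d g} → 1 ≤ α → 1 ≤ β → Balanced β α d g → Balanced α β d g
Balanced-comm {α} {β} {d} {g} 1≤α 1≤β b = record
  { partner     = partner
  ; partner-gap = trans (inΓ-comm α β partner 1≤α 1≤β) partner-gap
  ; W-partner   = λ {c} {c′} cond cond′ → begin
      W α β partner c′     ≡⟨ W-comm α β partner c′ 1≤α 1≤β ⟩
      W β α partner c′     ≡⟨ W-partner (transfer {g} cond) (transfer {partner} cond′) ⟩
      ℤ.- W β α g c        ≡⟨ cong ℤ.-_ (W-comm α β g c 1≤α 1≤β) ⟨
      ℤ.- W α β g c        ∎
  ; W<δ         = λ {c} cond → subst (ℤ._< ℤ.+ d) (sym (W-comm α β g c 1≤α 1≤β)) (W<δ (transfer {g} cond))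
  }
  where
  open Balanced b
  open ≡-Reasoning
  transfer : ∀ {h c} → IsConductor (inΔ α β h) c → IsConductor (inΔ β α h) c
  transfer {h} = conductor-cong (λ n → inΔ-comm α β h n 1≤α 1≤β)

module Extremes {α β : ℕ} (2≤α : 2 ≤ α) (2≤β : 2 ≤ β) (coprime : Coprime α β) where

  private
    module A = TwoGenerated α β 2≤α 2≤β coprime
    module B = TwoGenerated β α 2≤β 2≤α (Coprime.sym coprime)

  δΓ-comm : B.δΓ ≡ A.δΓ
  δΓ-comm = trans (cong (countBelow (inΓ β α)) (*-comm (β ∸ 1) (α ∸ 1)))
                  (countBelow-cong _ _ A.C (λ n _ → inΓ-comm β α n A.1≤β A.1≤α))

  gap-balanced : ∀ {g} → Gap α β g → Balanced α β A.δΓ g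
  gap-balanced {g} g∉Γ with p , q , 1≤p , 1≤q , r ← A.gap⇒reflected {g} g∉Γ with <-cmp (p * α) (q * β)
  ... | tri< pα<qβ _ _ = A.lower-gap-balanced {g} 1≤p 1≤q r pα<qβ
  ... | tri≈ _ pα≡qβ _ =
    ⊥-elim (<⇒≢ 1≤p (sym (coprime-multiple-small {k = p} {j = q} coprime pα≡qβ (A.α-coefficient<β {g} 1≤q r))))
  ... | tri> _ _ qβ<pα = subst (λ d → Balanced α β d g) δΓ-comm
                           (Balanced-comm A.1≤α A.1≤β (B.lower-gap-balanced {g} 1≤q 1≤p r′ qβ<pα))
    where
    r′ : g + q * β + p * α ≡ β * α
    r′ = trans (ring g p q α β) (trans r (*-comm α β))
      where
      ring : ∀ g p q α β → g + q * β + p * α ≡ g + p * α + q * β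
      ring = solve-∀

  cΔ : ℕ → ℕ
  cΔ g = conductorBelow (inΔ α β g) A.C

  cΔ-isConductor : ∀ g → IsConductor (inΔ α β g) (cΔ g)
  cΔ-isConductor g = conductorBelow-isConductor (inΔ α β g) A.C (λ n C≤n → ∨-trueˡ _ (proj₁ A.Γ-conductor n C≤n))

  δΓ-unique : ∀ {c} → IsConductor (inΓ α β) c → A.δΓ ≡ δ (inΓ α β) c
  δΓ-unique cond = cong (countBelow (inΓ α β)) (conductor-unique A.Γ-conductor cond)

  private
    open ℤ-Extrema using (argmax; argmax-all; v≤f[argmax]⁺)
    Wg : ℕ → ℤ
    Wg g = W α β g (cΔ g)
    gaps : List ℕ
    gaps = filter (λ g → inΓ α β g ≟ᵇ false) (upTo A.C)

  g* : ℕ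
  g* = argmax Wg 1 gaps

  g*-gap : Gap α β g*
  g*-gap = argmax-all Wg {P = Gap α β} (1∉Γ 2≤α 2≤β) (all-filter (λ g → inΓ α β g ≟ᵇ false) (upTo A.C))

  Wmax : ℤ
  Wmax = W α β g* (cΔ g*)

  W≤Wmax : ∀ g c → Gap α β g → IsConductor (inΔ α β g) c → W α β g c ℤ.≤ Wmax
  W≤Wmax g c g-gap cond = subst (λ c → W α β g c ℤ.≤ Wmax) (conductor-unique (cΔ-isConductor g) cond) Wg≤Wmax
    where
    g∈gaps : g ∈ gaps
    g∈gaps = ∈-filter⁺ (λ g → inΓ α β g ≟ᵇ false) (∈-upTo⁺ (A.gap<C {g} g-gap)) g-gap
    Wg≤Wmax : Wg g ℤ.≤ Wmax
    Wg≤Wmax = v≤f[argmax]⁺ 1 gaps (inj₂ (lose g∈gaps ℤ.≤-refl))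

  -Wmax≤W : ∀ g c → Gap α β g → IsConductor (inΔ α β g) c → ℤ.- Wmax ℤ.≤ W α β g c
  -Wmax≤W g c g-gap cond = begin
    ℤ.- Wmax                          ≤⟨ ℤ.neg-mono-≤ (W≤Wmax partner (cΔ partner) partner-gap (cΔ-isConductor partner)) ⟩
    ℤ.- W α β partner (cΔ partner)    ≡⟨ cong ℤ.-_ (W-partner cond (cΔ-isConductor partner)) ⟩
    ℤ.- ℤ.- W α β g c                 ≡⟨ ℤ.neg-involutive (W α β g c) ⟩
    W α β g c                         ∎
    where
    open Balanced (gap-balanced {g} g-gap)
    open ℤ.≤-Reasoning

open import Data.Integer using (+_; -_) renaming (_≤_ to _≤ℤ_; _<_ to _<ℤ_)

corollary4p6 : (α β : ℕ) → 2 ≤ α → 2 ≤ β → Coprime α β →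
    Σ ℤ (λ M →
      ((∃ λ g → Gap α β g × ∃ λ c → IsConductor (inΔ α β g) c × W α β g c ≡ M)
      × (∀ g c → Gap α β g → IsConductor (inΔ α β g) c → W α β g c ≤ℤ M))
      × ((∃ λ g → Gap α β g × ∃ λ c → IsConductor (inΔ α β g) c × W α β g c ≡ - M)
      × (∀ g c → Gap α β g → IsConductor (inΔ α β g) c → - M ≤ℤ W α β g c))
      × (∀ c → IsConductor (inΓ α β) c → M <ℤ + δ (inΓ α β) c))
corollary4p6 α β 2≤α 2≤β coprime =
  Wmax ,
  ((g* , g*-gap , cΔ g* , cΔ-isConductor g* , refl) , W≤Wmax) ,
  ((partner , partner-gap , cΔ partner , cΔ-isConductor partner , W-partner (cΔ-isConductor g*) (cΔ-isConductor partner)) ,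
   -Wmax≤W) ,
  λ _ cond → subst (λ d → Wmax <ℤ + d) (δΓ-unique cond) (W<δ (cΔ-isConductor g*))
  where
  open Extremes 2≤α 2≤β coprime
  open Balanced (gap-balanced {g*} g*-gap)
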